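{- Let $\lambda=\mu+\nu$ be a cancellation free decomposition with $\mu,\nu\in P$. For $\boldsymbol\psi\in\mathbf{Par}(\mu)$ and $\boldsymbol\omega\in\mathbf{Par}(\nu)$ we have (1) $\iota(\boldsymbol\psi*\boldsymbol\omega)=\iota(\boldsymbol\psi)+\iota(\boldsymbol\omega)$, and (2) $|\boldsymbol\psi*\boldsymbol\omega|=|\boldsymbol\psi|+|\boldsymbol\omega|+\langle\nu,\iota(\boldsymbol\psi)\rangle$.
   Context: $\Delta$ is the root system of $\mathfrak g$ (complex simple or type $A_1\times A_1$), simple coroots $\alpha_i^\vee$ ($i\in I$), fundamental weights $\varpi_i$, weight lattice $P$. Write $\mu=\sum_im_{i1}\varpi_i$, $\nu=\sum_im_{i2}\varpi_i$; cancellation free means that for each $i$ the nonzero ones among $m_{i1},m_{i2}$ have the same sign. For $\kappa=\sum_im_i\varpi_i\in P$, $\mathbf{Par}(\kappa)$ is the set of tuples $\boldsymbol\chi=(\chi^{(i)})_{i\in I}$ where $\chi^{(i)}=(\chi^{(i)}_1\ge\dots\ge\chi^{(i)}_{l_i}>0)$ is a partition of length $l_i\le\max\{m_i,0\}$; $|\boldsymbol\chi|=\sum_i\sum_k\chi^{(i)}_k$ and $\iota(\boldsymbol\chi)=\sum_i\chi^{(i)}_1\alpha_i^\vee$ (with $\chi^{(i)}_1=0$ if $\chi^{(i)}=\emptyset$). The map $*:\mathbf{Par}(\mu)\times\mathbf{Par}(\nu)\to\mathbf{Par}(\lambda)$, $(\boldsymbol\psi,\boldsymbol\omega)\mapsto\boldsymbol\chi=\boldsymbol\psi*\boldsymbol\omega$,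 is defined componentwise (identifying partitions with Young diagrams): if $m_{i1},m_{i2}\le0$ then $\chi^{(i)}=\emptyset$; otherwise ($m_{i1},m_{i2}\ge0$) take a rectangle with $m_{i2}$ rows of length $\psi^{(i)}_1$, attach $\omega^{(i)}$ to its right (top-justified) and $\psi^{(i)}$ below it (left-justified), and let $\chi^{(i)}$ be the resulting partition. -}

module Defs where

open import Data.Nat as ℕ using (ℕ; zero; suc; _<?_)
open import Data.Integer as ℤ using (ℤ; +_; -[1+_]; sign)
open import Data.Sign using (Sign)
open import Data.Fin using (Fin; zero; suc)
open import Data.List using (List; []; _∷_; _++_; map; filter; upTo; length)
open import Data.Nat.ListAction using (sum)
open import Data.List.Relation.Unary.All using (All)
open import Data.List.Relation.Unary.Linked using (Linked)
open import Data.Product using (_×_)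
open import Relation.Binary.PropositionalEquality using (_≡_; _≢_)

-- The index set I of simple roots is Fin n (n = rank).
-- A weight κ = Σ_i m_i ϖ_i ∈ P is identified with its coordinate
-- vector (m_i)_{i ∈ I} w.r.t. the fundamental weights.
Weight : ℕ → Set
Weight n = Fin n → ℤ

-- An element of the coroot lattice Σ_i c_i α_i^∨, by coordinates.
Coweight : ℕ → Set
Coweight n = Fin n → ℤ

pos : ℤ → ℕ
pos (+ k)      = k
pos -[1+ _ ]   = 0

CancellationFree : ∀ {n} → Weight n → Weight n → Set
CancellationFree μ ν = ∀ i → μ i ≢ + 0 → ν i ≢ + 0 → sign (μ i) ≡ sign (ν i)

IsPartition : List ℕ → Set
IsPartition χ = Linked ℕ._≥_ χ × All (ℕ._<_ 0) χ

Tuple : ℕ → Set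
Tuple n = Fin n → List ℕ

InPar : ∀ {n} → Weight n → Tuple n → Set
InPar κ χ = ∀ i → IsPartition (χ i) × length (χ i) ℕ.≤ pos (κ i)

first : List ℕ → ℕ
first []      = 0
first (x ∷ _) = x

part : List ℕ → ℕ → ℕ
part []       _       = 0
part (x ∷ _)  zero    = x
part (_ ∷ xs) (suc k) = part xs k

size : ∀ {n} → Tuple n → ℕ
size {zero}  χ = 0
size {suc n} χ = sum (χ zero) ℕ.+ size {n} (λ i → χ (suc i))

ι : ∀ {n} → Tuple n → Coweight n
ι χ i = + first (χ i)

Σℤ : ∀ n → (Fin n → ℤ) → ℤ
Σℤ zero    f = + 0
Σℤ (suc n) f = f zero ℤ.+ Σℤ n (λ i → f (suc i))

-- pairing ⟨κ, Σ_i c_i α_i^∨⟩ = Σ_i m_i c_i  (since ⟨ϖ_i, α_j^∨⟩ = δ_ij)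
pairing : ∀ {n} → Weight n → Coweight n → ℤ
pairing {n} κ c = Σℤ n (λ i → κ i ℤ.* c i)

-- One component of ψ * ω when m_{i1}, m_{i2} ≥ 0:
-- rows 1..m₂ of the diagram have length ψ_1 + ω_k (rectangle of m₂ rows of
-- length ψ_1 with ω attached on the right, top-justified), followed by the
-- rows of ψ below; the partition consists of the nonzero row lengths.
glue : ℕ → List ℕ → List ℕ → List ℕ
glue m₂ ψ ω = filter (0 <?_) (map (λ k → first ψ ℕ.+ part ω k) (upTo m₂) ++ ψ)

starComp : ℤ → ℤ → List ℕ → List ℕ → List ℕ
starComp (+ m₁) (+ m₂) ψ ω = glue m₂ ψ ω
starComp _      _      _ _ = []   -- case m_{i1}, m_{i2} ≤ 0 (under cancellation freeness)

star : ∀ {n} → Weight n → Weight n → Tuple n → Tuple n → Tuple n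
star μ ν ψ ω i = starComp (μ i) (ν i) (ψ i) (ω i)

-- Its first row is ψ₁ + ω₁, and its size is
-- |ψ| + |ω| + m₂ ψ₁, the extra term being the rectangle; summed over I, the rectangles
-- give ⟨ν, ι(ψ)⟩.  In the remaining coordinates cancellation freeness forces both
-- weights to be nonpositive, so ψ and ω are empty there and contribute nothing.
module Submission where

open import Defs
open import Data.Nat as ℕ using (ℕ; zero; suc; _<?_; z≤n; s≤s)
open import Data.Nat.Properties as ℕP using (m+n≡0⇒m≡0; m+n≡0⇒n≡0)
open import Data.Nat.ListAction using (sum)
open import Data.Nat.ListAction.Properties using (sum-++)
import Data.Nat.Tactic.RingSolver as ℕ-Solver
open import Data.Integer as ℤ using (ℤ; +_; -[1+_]; _+_; sign)
open import Data.Integer.Properties as ℤP using (pos-+; pos-*)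
open import Algebra.Properties.CommutativeSemigroup ℤP.+-commutativeSemigroup using (interchange)
import Data.Integer.Tactic.RingSolver as ℤ-Solver
open import Data.Fin using (Fin; zero; suc)
open import Data.Product using (_×_; _,_; proj₁; proj₂)
open import Data.List using (List; []; _∷_; _++_; map; filter; upTo; applyUpTo; length)
open import Data.List.Properties using (filter-all; filter-accept; map-upTo)
open import Data.List.Relation.Unary.All using (_∷_)
open import Relation.Binary.PropositionalEquality
open import Relation.Nullary using (yes; no)

private
  variable
    n : ℕ

first≡0⇒≡[] : ∀ {χ} → IsPartition χ → first χ ≡ 0 → χ ≡ []
first≡0⇒≡[] {[]}        _              _  = refl
first≡0⇒≡[] {zero ∷ _}  (_ , (() ∷ _)) _

part-zero : ∀ χ → part χ 0 ≡ first χ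
part-zero []      = refl
part-zero (_ ∷ _) = refl

sum-filter-positive : ∀ xs → sum (filter (0 <?_) xs) ≡ sum xs
sum-filter-positive []           = refl
sum-filter-positive (zero ∷ xs)  = sum-filter-positive xs
sum-filter-positive (suc x ∷ xs) = cong (suc x ℕ.+_) (sum-filter-positive xs)

sum-applyUpTo-+ : ∀ c (f : ℕ → ℕ) m →
  sum (applyUpTo (λ k → c ℕ.+ f k) m) ≡ m ℕ.* c ℕ.+ sum (applyUpTo f m)
sum-applyUpTo-+ c f zero    = refl
sum-applyUpTo-+ c f (suc m) = begin
  c ℕ.+ f 0 ℕ.+ sum (applyUpTo (λ k → c ℕ.+ f (suc k)) m)
    ≡⟨ cong (c ℕ.+ f 0 ℕ.+_) (sum-applyUpTo-+ c (λ k → f (suc k)) m) ⟩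
  c ℕ.+ f 0 ℕ.+ (m ℕ.* c ℕ.+ sum (applyUpTo (λ k → f (suc k)) m))
    ≡⟨ regroup c (f 0) m _ ⟩
  suc m ℕ.* c ℕ.+ (f 0 ℕ.+ sum (applyUpTo (λ k → f (suc k)) m)) ∎
  where
  open ≡-Reasoning
  regroup : ∀ c x m s → c ℕ.+ x ℕ.+ (m ℕ.* c ℕ.+ s) ≡ suc m ℕ.* c ℕ.+ (x ℕ.+ s)
  regroup = ℕ-Solver.solve-∀

sum-applyUpTo-part : ∀ χ m → length χ ℕ.≤ m → sum (applyUpTo (part χ) m) ≡ sum χ
sum-applyUpTo-part []      zero    _       = refl
sum-applyUpTo-part []      (suc m) _       = sum-applyUpTo-part [] m z≤n
sum-applyUpTo-part (x ∷ χ) (suc m) (s≤s l) = cong (x ℕ.+_) (sum-applyUpTo-part χ m l)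

glue-[]-[] : ∀ m → glue m [] [] ≡ []
glue-[]-[] m = zero-rows (upTo m)
  where
  zero-rows : ∀ ks → filter (0 <?_) (map (part []) ks ++ []) ≡ []
  zero-rows []       = refl
  zero-rows (_ ∷ ks) = zero-rows ks

first-glue : ∀ m ψ ω → IsPartition ψ → IsPartition ω → length ω ℕ.≤ m →
  first (glue m ψ ω) ≡ first ψ ℕ.+ first ω
first-glue zero ψ [] (_ , ψ>0) _ _ rewrite filter-all (0 <?_) ψ>0 = sym (ℕP.+-identityʳ _)
first-glue (suc m) ψ ω pψ pω _ with 0 <? first ψ ℕ.+ part ω 0
... | yes top>0 rewrite filter-accept (0 <?_) {xs = map (λ k → first ψ ℕ.+ part ω k) (applyUpTo suc m) ++ ψ} top>0
  = cong (first ψ ℕ.+_) (part-zero ω)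
... | no top≯0 = begin
  first (glue (suc m) ψ ω)  ≡⟨ cong₂ (λ ψ ω → first (glue (suc m) ψ ω)) ψ≡[] ω≡[] ⟩
  first (glue (suc m) [] []) ≡⟨ cong first (glue-[]-[] (suc m)) ⟩
  0                          ≡⟨ cong₂ ℕ._+_ (cong first ψ≡[]) (cong first ω≡[]) ⟨
  first ψ ℕ.+ first ω        ∎
  where
  open ≡-Reasoning
  top≡0 : first ψ ℕ.+ part ω 0 ≡ 0
  top≡0 = ℕP.n≤0⇒n≡0 (ℕP.≮⇒≥ top≯0)
  ψ≡[] : ψ ≡ []
  ψ≡[] = first≡0⇒≡[] pψ (m+n≡0⇒m≡0 (first ψ) top≡0)
  ω≡[] : ω ≡ []
  ω≡[] = first≡0⇒≡[] pω (trans (sym (part-zero ω)) (m+n≡0⇒n≡0 (first ψ) top≡0))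

sum-glue : ∀ m ψ ω → length ω ℕ.≤ m →
  + sum (glue m ψ ω) ≡ + sum ψ + + sum ω + + m ℤ.* + first ψ
sum-glue m ψ ω l = begin
  + sum (glue m ψ ω)                                ≡⟨ cong +_ sum-rows ⟩
  + (m ℕ.* first ψ ℕ.+ sum ω ℕ.+ sum ψ)             ≡⟨ lift (m ℕ.* first ψ) (sum ω) (sum ψ) ⟩
  + (m ℕ.* first ψ) + + sum ω + + sum ψ             ≡⟨ cong (λ z → z + + sum ω + + sum ψ) (pos-* m (first ψ)) ⟩
  + m ℤ.* + first ψ + + sum ω + + sum ψ             ≡⟨ regroup (+ m ℤ.* + first ψ) (+ sum ω) (+ sum ψ) ⟩
  + sum ψ + + sum ω + + m ℤ.* + first ψ             ∎
  where
  open ≡-Reasoning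
  row : ℕ → ℕ
  row k = first ψ ℕ.+ part ω k
  sum-rows : sum (glue m ψ ω) ≡ m ℕ.* first ψ ℕ.+ sum ω ℕ.+ sum ψ
  sum-rows = begin
    sum (glue m ψ ω)                                  ≡⟨ sum-filter-positive (map row (upTo m) ++ ψ) ⟩
    sum (map row (upTo m) ++ ψ)                       ≡⟨ sum-++ (map row (upTo m)) ψ ⟩
    sum (map row (upTo m)) ℕ.+ sum ψ                  ≡⟨ cong (λ rs → sum rs ℕ.+ sum ψ) (map-upTo row m) ⟩
    sum (applyUpTo row m) ℕ.+ sum ψ                   ≡⟨ cong (ℕ._+ sum ψ) (sum-applyUpTo-+ (first ψ) (part ω) m) ⟩
    m ℕ.* first ψ ℕ.+ sum (applyUpTo (part ω) m) ℕ.+ sum ψ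
      ≡⟨ cong (λ s → m ℕ.* first ψ ℕ.+ s ℕ.+ sum ψ) (sum-applyUpTo-part ω m l) ⟩
    m ℕ.* first ψ ℕ.+ sum ω ℕ.+ sum ψ                 ∎
  lift : ∀ a b c → + (a ℕ.+ b ℕ.+ c) ≡ + a + + b + + c
  lift a b c = trans (pos-+ (a ℕ.+ b) c) (cong (_+ + c) (pos-+ a b))
  regroup : ∀ (r w p : ℤ) → r + w + p ≡ p + w + r
  regroup = ℤ-Solver.solve-∀

empty-rows : ∀ b → + 0 ≡ + 0 + + 0 + b ℤ.* + 0
empty-rows b = sym (trans (ℤP.+-identityˡ (b ℤ.* + 0)) (ℤP.*-zeroʳ b))

first-sum-starComp : ∀ a b ψ ω → (a ≢ + 0 → b ≢ + 0 → sign a ≡ sign b) →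
  IsPartition ψ × length ψ ℕ.≤ pos a → IsPartition ω × length ω ℕ.≤ pos b →
  first (starComp a b ψ ω) ≡ first ψ ℕ.+ first ω
  × + sum (starComp a b ψ ω) ≡ + sum ψ + + sum ω + b ℤ.* + first ψ
first-sum-starComp (+ _)     (+ m₂)       ψ  ω  _  (pψ , _) (pω , lω) = first-glue m₂ ψ ω pψ pω lω , sum-glue m₂ ψ ω lω
first-sum-starComp (+ zero)  b@(-[1+ _ ]) [] [] _  _        (_ , z≤n) = refl , empty-rows b
first-sum-starComp (+ suc _) -[1+ _ ]     _  _  cf _        _         with () ← cf (λ ()) (λ ())
first-sum-starComp -[1+ _ ]  b@(+ zero)   [] [] _  _        _         = refl , empty-rows b
first-sum-starComp -[1+ _ ]  (+ suc _)    _  _  cf _        _         with () ← cf (λ ()) (λ ())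
first-sum-starComp -[1+ _ ]  b@(-[1+ _ ]) [] [] _  _        _         = refl , empty-rows b

Σℤ-cong : ∀ {f g : Fin n → ℤ} → (∀ i → f i ≡ g i) → Σℤ n f ≡ Σℤ n g
Σℤ-cong {zero}  _   = refl
Σℤ-cong {suc n} f≗g = cong₂ _+_ (f≗g zero) (Σℤ-cong (λ i → f≗g (suc i)))

Σℤ-+ : ∀ (f g : Fin n → ℤ) → Σℤ n (λ i → f i + g i) ≡ Σℤ n f + Σℤ n g
Σℤ-+ {zero}  f g = refl
Σℤ-+ {suc n} f g = trans (cong (_+_ (f zero + g zero)) (Σℤ-+ (λ i → f (suc i)) (λ i → g (suc i))))
                         (interchange (f zero) (g zero) _ _)

size≡Σℤ-sum : ∀ (χ : Tuple n) → + size χ ≡ Σℤ n (λ i → + sum (χ i))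
size≡Σℤ-sum {zero}  χ = refl
size≡Σℤ-sum {suc n} χ = trans (pos-+ (sum (χ zero)) _) (cong (_+_ (+ sum (χ zero))) (size≡Σℤ-sum (λ i → χ (suc i))))

size-pointwise : ∀ (χ ψ ω : Tuple n) (c : Fin n → ℤ) →
  (∀ i → + sum (χ i) ≡ + sum (ψ i) + + sum (ω i) + c i) →
  + size χ ≡ + size ψ + + size ω + Σℤ n c
size-pointwise {n} χ ψ ω c h = begin
  + size χ                                              ≡⟨ size≡Σℤ-sum χ ⟩
  Σℤ n (λ i → + sum (χ i))                              ≡⟨ Σℤ-cong h ⟩
  Σℤ n (λ i → + sum (ψ i) + + sum (ω i) + c i)          ≡⟨ Σℤ-+ _ c ⟩
  Σℤ n (λ i → + sum (ψ i) + + sum (ω i)) + Σℤ n c       ≡⟨ cong (_+ Σℤ n c) (Σℤ-+ (λ i → + sum (ψ i)) (λ i → + sum (ω i))) ⟩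
  Σℤ n (λ i → + sum (ψ i)) + Σℤ n (λ i → + sum (ω i)) + Σℤ n c
    ≡⟨ cong₂ (λ s t → s + t + Σℤ n c) (size≡Σℤ-sum ψ) (size≡Σℤ-sum ω) ⟨
  + size ψ + + size ω + Σℤ n c                          ∎
  where open ≡-Reasoning

lemma5p13 : (n : ℕ) (μ ν : Weight n) → CancellationFree μ ν →
    (ψ ω : Tuple n) → InPar μ ψ → InPar ν ω →
    ((i : Fin n) → ι (star μ ν ψ ω) i ≡ ι ψ i + ι ω i)
    × (+ size (star μ ν ψ ω) ≡ + size ψ + + size ω + pairing ν (ι ψ))
lemma5p13 n μ ν cf ψ ω ψ∈Par ω∈Par =
  (λ i → trans (cong +_ (proj₁ (coordinate i))) (pos-+ (first (ψ i)) (first (ω i))))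
  , size-pointwise (star μ ν ψ ω) ψ ω (λ i → ν i ℤ.* ι ψ i) (λ i → proj₂ (coordinate i))
  where
  coordinate : ∀ i → first (star μ ν ψ ω i) ≡ first (ψ i) ℕ.+ first (ω i)
                   × + sum (star μ ν ψ ω i) ≡ + sum (ψ i) + + sum (ω i) + ν i ℤ.* ι ψ i
  coordinate i = first-sum-starComp (μ i) (ν i) (ψ i) (ω i) (cf i) (ψ∈Par i) (ω∈Par i)
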